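{- If $T\in B^0_k(G)$, then $T$ has a unique set of $k-1$ edges whose removal partitions $G$ into $k$ connected pieces of equal population.
   Context: $G$ is a connected graph with vertex populations $p:V(G)\to\mathbb{R}^+$ (strictly positive) and total population $p(G)$; $k\ge2$ is an integer. $B^0_k(G)$ is the set of spanning trees $T$ of $G$ containing $k-1$ edges whose removal partitions $G$ into $k$ connected components each of population exactly $p(G)/k$.
   Formalization: The vertex populations take values in the strictly positive rationals rather than in $\mathbb{R}^+$. -}

module Defs where

open import Data.Nat using (ℕ; zero; suc; _∸_)
open import Data.Fin using (Fin; zero; suc)
open import Data.Fin.Subset using (Subset; _∈_; _∉_; _⊆_; ∣_∣; _─_; _-_; ⊤)
open import Data.Product using (Σ; _×_; _,_; proj₁; proj₂; ∃; ∃-syntax)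
open import Data.Integer using (+_)
open import Data.Rational using (ℚ; 0ℚ; _+_; _*_; _/_; Positive)
open import Relation.Binary.PropositionalEquality using (_≡_)
open import Relation.Nullary using (¬_; Dec; yes; no)
open import Data.Fin using (_≟_)
open import Function.Bundles using (_⇔_)

-- A finite (multi)graph on vertex set Fin n with m edges, edge e having
-- endpoints (proj₁ (ends e) , proj₂ (ends e)).  Edge sets of subgraphs are
-- subsets of Fin m.
record Graph (n m : ℕ) : Set where
  field
    ends : Fin m → Fin n × Fin n
open Graph public

data Reach {n m : ℕ} (G : Graph n m) (H : Subset m) : Fin n → Fin n → Set where
  here : ∀ {v} → Reach G H v v
  fwd  : ∀ {u} (e : Fin m) → e ∈ H →
         Reach G H u (proj₁ (ends G e)) → Reach G H u (proj₂ (ends G e))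
  bwd  : ∀ {u} (e : Fin m) → e ∈ H →
         Reach G H u (proj₂ (ends G e)) → Reach G H u (proj₁ (ends G e))

Connected : ∀ {n m} → Graph n m → Subset m → Set
Connected G H = ∀ u v → Reach G H u v

-- Acyclic: every edge of H is a bridge (its endpoints are disconnected
-- once it is removed), i.e. H contains no cycle (loops included).
Acyclic : ∀ {n m} → Graph n m → Subset m → Set
Acyclic G H = ∀ e → e ∈ H → ¬ Reach G (H - e) (proj₁ (ends G e)) (proj₂ (ends G e))

SpanningTree : ∀ {n m} → Graph n m → Subset m → Set
SpanningTree G T = Connected G T × Acyclic G T

sumFin : ∀ {n} → (Fin n → ℚ) → ℚ
sumFin {zero}  f = 0ℚ
sumFin {suc n} f = f zero + sumFin (λ i → f (suc i))

totalPop : ∀ {n} → (Fin n → ℚ) → ℚ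
totalPop p = sumFin p

classPop : ∀ {n k} → (Fin n → ℚ) → (Fin n → Fin k) → Fin k → ℚ
classPop p c i = sumFin (λ v → pick (c v ≟ i) (p v))
  where
    pick : ∀ {P : Set} → Dec P → ℚ → ℚ
    pick (yes _) q = q
    pick (no _)  q = 0ℚ

-- Removing the edges S from the tree T partitions G into exactly k connected
-- components each of population p(G)/k: the components of the forest T ─ S
-- are exactly the fibres of a surjective labelling c : Fin n → Fin k, and
-- k · p(component) = p(G) for each of them.
EqualSplit : ∀ {n m} → Graph n m → (Fin n → ℚ) → (k : ℕ) → Subset m → Subset m → Set
EqualSplit {n} G p k T S =
  Σ (Fin n → Fin k) λ c →
    (∀ (i : Fin k) → ∃[ v ] c v ≡ i) ×
    (∀ v w → (c v ≡ c w) ⇔ Reach G (T ─ S) v w) ×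
    (∀ (i : Fin k) → ((+ k) / 1) * classPop p c i ≡ totalPop p)

ValidCut : ∀ {n m} → Graph n m → (Fin n → ℚ) → (k : ℕ) → Subset m → Subset m → Set
ValidCut G p k T S = S ⊆ T × ∣ S ∣ ≡ k ∸ 1 × EqualSplit G p k T S

B0 : ∀ {n m} → Graph n m → (Fin n → ℚ) → (k : ℕ) → Subset m → Set
B0 {n} {m} G p k T = SpanningTree G T × Σ (Subset m) (λ S → ValidCut G p k T S)

{-# OPTIONS --safe #-}

-- Let S, S′ be valid cuts and e ∈ S ∖ S′, and let A be the vertex set of the component of
-- T − e containing the first endpoint u of e; the other endpoint v lies outside A since T
-- is acyclic.  No component of T ─ S straddles A, so k·p(A) is a multiple of p(G).  Among
-- the components of T ─ S′ only the one containing e straddles A (it holds u but not v);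
-- as populations are positive it contributes strictly between 0 and p(G)/k to p(A), so
-- k·p(A) lies strictly between two consecutive multiples of p(G).  Membership in A need
-- not be decidable constructively, but since the goal is ⊥ we may assume it is.
module Submission where

open import Defs
open import Level using (0ℓ)
open import Data.Nat as ℕ using (ℕ; zero; suc; _≤_; z≤n; s≤s; NonZero)
import Data.Nat.Properties as ℕ
open import Data.Bool using (if_then_else_)
open import Data.Fin using (Fin; zero; suc; _≟_)
open import Data.Fin.Properties using (punchInᵢ≢i; sequence)
open import Data.Fin.Subset using (Subset; ⊤; _∈_; _∉_; _⊆_; _─_; _-_)
open import Data.Fin.Subset.Properties
  using (_∈?_; ⊆-antisym; x∈p∧x∉q⇒x∈p─q; p─q⊆p; x∈p∧x≢y⇒x∈p-y)
open import Data.Vec using (_∷_; here; there)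
open import Data.Vec.Functional using (removeAt)
import Data.Integer as ℤ
open import Data.Rational as ℚ using (ℚ; 0ℚ; _+_; _*_; _/_; Positive)
open import Data.Rational.Properties
  using (+-0-monoid; +-*-commutativeRing; +-identityʳ; +-comm; *-zeroʳ;
         ≤-refl; <⇒≤; <-trans; <-irrefl; +-mono-≤; +-monoʳ-≤; +-mono-<-≤; +-mono-≤-<;
         +-monoʳ-<; *-monoʳ-<-pos; positive⁻¹; normalize-pos; module ≤-Reasoning)
open import Data.Product using (∃!; ∃-syntax; _,_; proj₁; proj₂)
open import Data.Sum using ([_,_])
open import Data.Empty using (⊥)
open import Function using (_∘_; const; Equivalence)
open import Algebra.Bundles using (CommutativeRing)
open import Effect.Monad using (RawMonad)
open import Relation.Nullary using (¬_; yes; no; does)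
open import Relation.Nullary.Negation using (¬¬-Monad; contradiction)
open import Relation.Nullary.Decidable using (¬¬-excluded-middle; decidable-stable)
open import Relation.Unary using (Pred; Decidable)
open import Relation.Binary.PropositionalEquality
  using (_≡_; _≢_; refl; sym; trans; cong; cong₂; subst; subst₂; module ≡-Reasoning)

open import Algebra.Properties.Monoid.Mult +-0-monoid using (_×_; ×-homo-+)
open import Algebra.Properties.Semiring.Sum (CommutativeRing.semiring +-*-commutativeRing)
  using (sum; sum-cong-≗; sum-remove; sum-replicate-zero; ∑-comm; *-distribˡ-sum)

×-nonNeg : ∀ n {x} → 0ℚ ℚ.≤ x → 0ℚ ℚ.≤ n × x
×-nonNeg zero    0≤x = ≤-refl
×-nonNeg (suc n) 0≤x = +-mono-≤ 0≤x (×-nonNeg n 0≤x)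

×-monoˡ-≤ : ∀ {m n x} → 0ℚ ℚ.≤ x → m ≤ n → m × x ℚ.≤ n × x
×-monoˡ-≤ {n = n} 0≤x z≤n       = ×-nonNeg n 0≤x
×-monoˡ-≤ {x = x} 0≤x (s≤s m≤n) = +-monoʳ-≤ x (×-monoˡ-≤ 0≤x m≤n)

×-≢-+ : ∀ m n {x r} → 0ℚ ℚ.< r → r ℚ.< x → m × x ≢ n × x + r
×-≢-+ m n {x} {r} 0<r r<x mx≡nx+r = [ below , above ] (ℕ.≤-<-connex m n)
  where
  open ≤-Reasoning
  0≤x : 0ℚ ℚ.≤ x
  0≤x = <⇒≤ (<-trans 0<r r<x)

  below : m ≤ n → ⊥
  below m≤n = <-irrefl mx≡nx+r (begin-strict
    m × x       ≤⟨ ×-monoˡ-≤ 0≤x m≤n ⟩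
    n × x       ≡⟨ sym (+-identityʳ (n × x)) ⟩
    n × x + 0ℚ  <⟨ +-monoʳ-< (n × x) 0<r ⟩
    n × x + r   ∎)

  above : n ℕ.< m → ⊥
  above n<m = <-irrefl (sym mx≡nx+r) (begin-strict
    n × x + r   <⟨ +-monoʳ-< (n × x) r<x ⟩
    n × x + x   ≡⟨ +-comm (n × x) x ⟩
    suc n × x   ≤⟨ ×-monoˡ-≤ 0≤x n<m ⟩
    m × x       ∎)

Multiple : ℚ → ℚ → Set
Multiple x q = ∃[ j ] q ≡ j × x

sum-multiple : ∀ {n x} (f : Fin n → ℚ) → (∀ i → Multiple x (f i)) → Multiple x (sum f)
sum-multiple {zero}      f mult = 0 , refl
sum-multiple {suc n} {x} f mult
  with mult zero | sum-multiple (f ∘ suc) (mult ∘ suc)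
... | j , f₀≡jx | j′ , Σf≡j′x = j ℕ.+ j′ , (begin
  f zero + sum (f ∘ suc)  ≡⟨ cong₂ _+_ f₀≡jx Σf≡j′x ⟩
  j × x + j′ × x          ≡⟨ sym (×-homo-+ x j j′) ⟩
  (j ℕ.+ j′) × x          ∎)
  where open ≡-Reasoning

sum-multiple-except : ∀ {n x} (f : Fin n → ℚ) i → (∀ l → l ≢ i → Multiple x (f l)) →
                      ∃[ j ] sum f ≡ j × x + f i
sum-multiple-except {suc n} {x} f i mult
  with sum-multiple (removeAt f i) (λ l → mult _ (punchInᵢ≢i i l))
... | j , rest≡jx = j , (begin
  sum f                     ≡⟨ sum-remove f ⟩
  f i + sum (removeAt f i)  ≡⟨ cong (f i +_) rest≡jx ⟩
  f i + j × x               ≡⟨ +-comm (f i) (j × x) ⟩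
  j × x + f i               ∎)
  where open ≡-Reasoning

sum-mono-≤ : ∀ {n} {f g : Fin n → ℚ} → (∀ i → f i ℚ.≤ g i) → sum f ℚ.≤ sum g
sum-mono-≤ {zero}  f≤g = ≤-refl
sum-mono-≤ {suc n} f≤g = +-mono-≤ (f≤g zero) (sum-mono-≤ (f≤g ∘ suc))

sum-mono-< : ∀ {n} {f g : Fin n → ℚ} → (∀ i → f i ℚ.≤ g i) → ∀ j → f j ℚ.< g j → sum f ℚ.< sum g
sum-mono-< f≤g zero    fj<gj = +-mono-<-≤ fj<gj (sum-mono-≤ (f≤g ∘ suc))
sum-mono-< f≤g (suc j) fj<gj = +-mono-≤-< (f≤g zero) (sum-mono-< (f≤g ∘ suc) j fj<gj)

restrict : ∀ {n} {A : Pred (Fin n) 0ℓ} → Decidable A → (Fin n → ℚ) → Fin n → ℚ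
restrict A? f w = if does (A? w) then f w else 0ℚ

module _ {n} {A : Pred (Fin n) 0ℓ} (A? : Decidable A) where

  restrict-∈ : ∀ {f w} → A w → restrict A? f w ≡ f w
  restrict-∈ {w = w} a with A? w
  ... | yes _ = refl
  ... | no ¬a = contradiction a ¬a

  restrict-∉ : ∀ {f w} → ¬ A w → restrict A? f w ≡ 0ℚ
  restrict-∉ {w = w} ¬a with A? w
  ... | yes a = contradiction a ¬a
  ... | no _  = refl

  restrict-zero : ∀ w → restrict A? (const 0ℚ) w ≡ 0ℚ
  restrict-zero w with A? w
  ... | yes _ = refl
  ... | no _  = refl

  restrict-cong : ∀ {f g} → (∀ {w} → A w → f w ≡ g w) → ∀ w → restrict A? f w ≡ restrict A? g w
  restrict-cong f≡g w with A? w
  ... | yes a = f≡g a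
  ... | no _  = refl

  restrict-mono-≤ : ∀ {f g} → (∀ w → f w ℚ.≤ g w) → ∀ w → restrict A? f w ℚ.≤ restrict A? g w
  restrict-mono-≤ f≤g w with A? w
  ... | yes _ = f≤g w
  ... | no _  = ≤-refl

  restrict-nonNeg : ∀ {f w} → 0ℚ ℚ.≤ f w → 0ℚ ℚ.≤ restrict A? f w
  restrict-nonNeg {w = w} 0≤fw with A? w
  ... | yes _ = 0≤fw
  ... | no _  = ≤-refl

  restrict-≤ : ∀ {f w} → 0ℚ ℚ.≤ f w → restrict A? f w ℚ.≤ f w
  restrict-≤ {w = w} 0≤fw with A? w
  ... | yes _ = ≤-refl
  ... | no _  = 0≤fw

sum-indicator : ∀ {k} (j : Fin k) x → sum (restrict (j ≟_) (const x)) ≡ x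
sum-indicator {suc k} j x = begin
  sum δ                     ≡⟨ sum-remove δ ⟩
  δ j + sum (removeAt δ j)  ≡⟨ cong₂ _+_ (restrict-∈ (j ≟_) refl) rest≡0 ⟩
  x + 0ℚ                    ≡⟨ +-identityʳ x ⟩
  x                         ∎
  where
  open ≡-Reasoning
  δ : Fin (suc k) → ℚ
  δ = restrict (j ≟_) (const x)
  rest≡0 : sum (removeAt δ j) ≡ 0ℚ
  rest≡0 = trans (sum-cong-≗ (λ l → restrict-∉ (j ≟_) (punchInᵢ≢i j l ∘ sym)))
                 (sum-replicate-zero k)

classPop≡sum : ∀ {n k} (f : Fin n → ℚ) (c : Fin n → Fin k) i →
               classPop f c i ≡ sum (restrict (λ w → c w ≟ i) f)
classPop≡sum {zero}  f c i = refl
classPop≡sum {suc n} f c i with c zero ≟ i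
... | yes _ = cong (f zero +_) (classPop≡sum (f ∘ suc) (c ∘ suc) i)
... | no _  = cong (0ℚ +_) (classPop≡sum (f ∘ suc) (c ∘ suc) i)

sum≡sum-classPop : ∀ {n k} (f : Fin n → ℚ) (c : Fin n → Fin k) → sum f ≡ sum (classPop f c)
sum≡sum-classPop f c = begin
  sum f                                              ≡⟨ sum-cong-≗ (λ w → sym (sum-indicator (c w) (f w))) ⟩
  sum (λ w → sum (restrict (c w ≟_) (const (f w))))  ≡⟨ ∑-comm (λ w → restrict (c w ≟_) (const (f w))) ⟩
  sum (λ i → sum (restrict (λ w → c w ≟ i) f))       ≡⟨ sum-cong-≗ (λ i → sym (classPop≡sum f c i)) ⟩
  sum (classPop f c)                                 ∎
  where open ≡-Reasoning

module _ {n k} (c : Fin n → Fin k) (i : Fin k) where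

  classPop-cong : ∀ {f g} → (∀ {w} → c w ≡ i → f w ≡ g w) → classPop f c i ≡ classPop g c i
  classPop-cong {f} {g} f≡g = begin
    classPop f c i                     ≡⟨ classPop≡sum f c i ⟩
    sum (restrict (λ w → c w ≟ i) f)   ≡⟨ sum-cong-≗ (restrict-cong (λ w → c w ≟ i) {f} {g} f≡g) ⟩
    sum (restrict (λ w → c w ≟ i) g)   ≡⟨ sym (classPop≡sum g c i) ⟩
    classPop g c i                     ∎
    where open ≡-Reasoning

  classPop-zero : classPop (const 0ℚ) c i ≡ 0ℚ
  classPop-zero = begin
    classPop (const 0ℚ) c i                     ≡⟨ classPop≡sum (const 0ℚ) c i ⟩
    sum (restrict (λ w → c w ≟ i) (const 0ℚ))   ≡⟨ sum-cong-≗ (restrict-zero (λ w → c w ≟ i)) ⟩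
    sum {n} (const 0ℚ)                          ≡⟨ sum-replicate-zero n ⟩
    0ℚ                                          ∎
    where open ≡-Reasoning

  classPop-mono-< : ∀ {f g} → (∀ w → f w ℚ.≤ g w) → ∀ {w} → c w ≡ i → f w ℚ.< g w →
                    classPop f c i ℚ.< classPop g c i
  classPop-mono-< {f} {g} f≤g {w} cw≡i fw<gw = begin-strict
    classPop f c i                     ≡⟨ classPop≡sum f c i ⟩
    sum (restrict (λ w → c w ≟ i) f)   <⟨ sum-mono-< (restrict-mono-≤ (λ w → c w ≟ i) {f} {g} f≤g) w
                                            (subst₂ ℚ._<_ (sym (restrict-∈ (λ w → c w ≟ i) {f} cw≡i))
                                                        (sym (restrict-∈ (λ w → c w ≟ i) {g} cw≡i)) fw<gw) ⟩
    sum (restrict (λ w → c w ≟ i) g)   ≡⟨ sym (classPop≡sum g c i) ⟩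
    classPop g c i                     ∎
    where open ≤-Reasoning

Unsplit : ∀ {n k} → (Fin n → Fin k) → Pred (Fin n) 0ℓ → Fin k → Set
Unsplit c A i = ∀ {x y} → c x ≡ i → c y ≡ i → A x → A y

module BalancedLabelling {n k} (p : Fin n → ℚ) (c : Fin n → Fin k)
  (onto : ∀ i → ∃[ w ] c w ≡ i)
  (K : ℚ) (balanced : ∀ i → K * classPop p c i ≡ totalPop p)
  {A : Pred (Fin n) 0ℓ} (A? : Decidable A) where

  P : ℚ
  P = totalPop p

  pA : Fin n → ℚ
  pA = restrict A? p

  K*popA≡sum : K * sum pA ≡ sum (λ i → K * classPop pA c i)
  K*popA≡sum = trans (cong (K *_) (sum≡sum-classPop pA c)) (*-distribˡ-sum K (classPop pA c))

  unsplit-multiple : ∀ i → Unsplit c A i → Multiple P (K * classPop pA c i)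
  unsplit-multiple i unsplit with onto i
  ... | r , cr≡i with A? r
  ...   | yes Ar = 1 , (begin
    K * classPop pA c i  ≡⟨ cong (K *_) (classPop-cong c i (restrict-∈ A? {p} ∘ inside)) ⟩
    K * classPop p c i   ≡⟨ balanced i ⟩
    P                    ≡⟨ sym (+-identityʳ P) ⟩
    1 × P                ∎)
    where
    open ≡-Reasoning
    inside : ∀ {w} → c w ≡ i → A w
    inside cw≡i = unsplit cr≡i cw≡i Ar
  ...   | no ¬Ar = 0 , (begin
    K * classPop pA c i           ≡⟨ cong (K *_) (classPop-cong c i (restrict-∉ A? {p} ∘ outside)) ⟩
    K * classPop (const 0ℚ) c i   ≡⟨ cong (K *_) (classPop-zero c i) ⟩
    K * 0ℚ                        ≡⟨ *-zeroʳ K ⟩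
    0 × P                         ∎)
    where
    open ≡-Reasoning
    outside : ∀ {w} → c w ≡ i → ¬ A w
    outside cw≡i Aw = ¬Ar (unsplit cw≡i cr≡i Aw)

  multiple-if-unsplit : (∀ i → Unsplit c A i) → Multiple P (K * sum pA)
  multiple-if-unsplit unsplit =
    subst (Multiple P) (sym K*popA≡sum) (sum-multiple _ (λ i → unsplit-multiple i (unsplit i)))

  module _ .{{_ : Positive K}} (pos : ∀ w → Positive (p w))
    {u v} (Au : A u) (¬Av : ¬ A v) (cu≡cv : c u ≡ c v) where

    p>0 : ∀ w → 0ℚ ℚ.< p w
    p>0 w = positive⁻¹ (p w) {{pos w}}

    K*-< : ∀ {x y} → x ℚ.< y → K * x ℚ.< K * y
    K*-< = *-monoʳ-<-pos K

    split-class-pos : 0ℚ ℚ.< K * classPop pA c (c u)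
    split-class-pos = begin-strict
      0ℚ                                ≡⟨ sym (*-zeroʳ K) ⟩
      K * 0ℚ                            ≡⟨ cong (K *_) (sym (classPop-zero c (c u))) ⟩
      K * classPop (const 0ℚ) c (c u)   <⟨ K*-< (classPop-mono-< c (c u)
                                             (λ w → restrict-nonNeg A? {p} (<⇒≤ (p>0 w))) refl
                                             (subst (0ℚ ℚ.<_) (sym (restrict-∈ A? {p} Au)) (p>0 u))) ⟩
      K * classPop pA c (c u)           ∎
      where open ≤-Reasoning

    split-class-< : K * classPop pA c (c u) ℚ.< P
    split-class-< = begin-strict
      K * classPop pA c (c u)  <⟨ K*-< (classPop-mono-< c (c u)
                                   (λ w → restrict-≤ A? {p} (<⇒≤ (p>0 w))) (sym cu≡cv)
                                   (subst (ℚ._< p v) (sym (restrict-∉ A? {p} ¬Av)) (p>0 v))) ⟩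
      K * classPop p c (c u)   ≡⟨ balanced (c u) ⟩
      P                        ∎
      where open ≤-Reasoning

    not-multiple-if-split-once : (∀ i → i ≢ c u → Unsplit c A i) → ¬ Multiple P (K * sum pA)
    not-multiple-if-split-once unsplit (j , K*popA≡jP)
      with sum-multiple-except (λ i → K * classPop pA c i) (c u)
             (λ i i≢cu → unsplit-multiple i (unsplit i i≢cu))
    ... | j′ , sum≡j′P+r = ×-≢-+ j j′ split-class-pos split-class-< (begin
      j × P                            ≡⟨ sym K*popA≡jP ⟩
      K * sum pA                       ≡⟨ K*popA≡sum ⟩
      sum (λ i → K * classPop pA c i)  ≡⟨ sum≡j′P+r ⟩
      j′ × P + K * classPop pA c (c u) ∎)
      where open ≡-Reasoning

x∈p─q⇒x∉q : ∀ {n} {x : Fin n} (p q : Subset n) → x ∈ p ─ q → x ∉ q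
x∈p─q⇒x∉q (_ ∷ p) (_ ∷ q) (there x∈p─q) (there x∈q) = x∈p─q⇒x∉q p q x∈p─q x∈q

¬¬-decidable : ∀ {n} (A : Pred (Fin n) 0ℓ) → ¬ ¬ Decidable A
¬¬-decidable A = sequence (RawMonad.rawApplicative ¬¬-Monad) (λ _ → ¬¬-excluded-middle)

module _ {n m} (G : Graph n m) where

  Reach-mono : ∀ {H H′} → H ⊆ H′ → ∀ {x y} → Reach G H x y → Reach G H′ x y
  Reach-mono H⊆H′ here         = here
  Reach-mono H⊆H′ (fwd e e∈H r) = fwd e (H⊆H′ e∈H) (Reach-mono H⊆H′ r)
  Reach-mono H⊆H′ (bwd e e∈H r) = bwd e (H⊆H′ e∈H) (Reach-mono H⊆H′ r)

  Reach-trans : ∀ {H x y z} → Reach G H x y → Reach G H y z → Reach G H x z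
  Reach-trans r here           = r
  Reach-trans r (fwd e e∈H r′) = fwd e e∈H (Reach-trans r r′)
  Reach-trans r (bwd e e∈H r′) = bwd e e∈H (Reach-trans r r′)

  -- d is constant along the path and equal at both ends of e, so the path never reaches e.
  Reach-avoid : ∀ {k H T} (d : Fin n → Fin k) → (∀ {x y} → Reach G H x y → d x ≡ d y) →
                H ⊆ T → ∀ e {w y} → d w ≢ d (proj₁ (ends G e)) →
                Reach G H w y → Reach G (T - e) w y
  Reach-avoid d constant H⊆T e dw≢ here = here
  Reach-avoid d constant H⊆T e dw≢ (fwd e′ e′∈H r) with e′ ≟ e
  ... | yes refl = contradiction (constant r) dw≢
  ... | no e′≢e  = fwd e′ (x∈p∧x≢y⇒x∈p-y (H⊆T e′∈H) e′≢e) (Reach-avoid d constant H⊆T e dw≢ r)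
  Reach-avoid d constant H⊆T e dw≢ (bwd e′ e′∈H r) with e′ ≟ e
  ... | yes refl = contradiction (trans (constant r) (sym (constant (fwd e e′∈H here)))) dw≢
  ... | no e′≢e  = bwd e′ (x∈p∧x≢y⇒x∈p-y (H⊆T e′∈H) e′≢e) (Reach-avoid d constant H⊆T e dw≢ r)

module _ {n m} (G : Graph n m) (p : Fin n → ℚ) (k : ℕ) .{{_ : NonZero k}}
  (pos : ∀ v → Positive (p v)) {T : Subset m} (acyclic : Acyclic G T) where

  ValidCut-⊆ : ∀ {S S′} → ValidCut G p k T S → ValidCut G p k T S′ → S ⊆ S′
  ValidCut-⊆ {S} {S′} (S⊆T , _ , c , onto , c≡⇔Reach , balanced)
                      (_ , _ , c′ , onto′ , c′≡⇔Reach′ , balanced′) {e} e∈S =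
    decidable-stable (e ∈? S′) λ e∉S′ → ¬¬-decidable A λ A? →
      BalancedLabelling.not-multiple-if-split-once p c′ onto′ K balanced′ A? {{K>0}} pos
        here (acyclic e (S⊆T e∈S)) (c′u≡c′v e∉S′) c′-unsplit
        (BalancedLabelling.multiple-if-unsplit p c onto K balanced A? c-unsplit)
    where
    K : ℚ
    K = (ℤ.+ k) / 1
    K>0 : Positive K
    K>0 = normalize-pos k 1

    u v : Fin n
    u = proj₁ (ends G e)
    v = proj₂ (ends G e)

    A : Pred (Fin n) 0ℓ
    A = Reach G (T - e) u

    T─S⊆T-e : T ─ S ⊆ T - e
    T─S⊆T-e x∈T─S = x∈p∧x≢y⇒x∈p-y (p─q⊆p T S x∈T─S) λ { refl → x∈p─q⇒x∉q T S x∈T─S e∈S }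

    c-unsplit : ∀ i → Unsplit c A i
    c-unsplit i {x} {y} cx≡i cy≡i Ax =
      Reach-trans G Ax (Reach-mono G T─S⊆T-e (Equivalence.to (c≡⇔Reach x y) (trans cx≡i (sym cy≡i))))

    c′-constant : ∀ {x y} → Reach G (T ─ S′) x y → c′ x ≡ c′ y
    c′-constant {x} {y} = Equivalence.from (c′≡⇔Reach′ x y)

    c′u≡c′v : e ∉ S′ → c′ u ≡ c′ v
    c′u≡c′v e∉S′ = c′-constant (fwd e (x∈p∧x∉q⇒x∈p─q (S⊆T e∈S) e∉S′) here)

    c′-unsplit : ∀ i → i ≢ c′ u → Unsplit c′ A i
    c′-unsplit i i≢c′u {x} {y} c′x≡i c′y≡i Ax =
      Reach-trans G Ax (Reach-avoid G c′ c′-constant (p─q⊆p T S′) e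
        (λ c′x≡c′u → i≢c′u (trans (sym c′x≡i) c′x≡c′u))
        (Equivalence.to (c′≡⇔Reach′ x y) (trans c′x≡i (sym c′y≡i))))

lemma3p1 : ∀ {n m} (G : Graph n m) (p : Fin n → ℚ) (k : ℕ) →
    2 ≤ k → (∀ v → Positive (p v)) → Connected G ⊤ →
    (T : Subset m) → B0 G p k T →
    ∃! _≡_ (λ S → ValidCut G p k T S)
lemma3p1 G p k 2≤k pos _ T ((_ , acyclic) , S , cut) =
  S , cut , λ cut′ → ⊆-antisym (cut⊆cut cut cut′) (cut⊆cut cut′ cut)
  where
  instance
    k≢0 : NonZero k
    k≢0 = ℕ.>-nonZero (ℕ.≤-trans (s≤s z≤n) 2≤k)

  cut⊆cut : ∀ {S S′} → ValidCut G p k T S → ValidCut G p k T S′ → S ⊆ S′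
  cut⊆cut = ValidCut-⊆ G p k pos acyclic
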